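{- Let $D$ be a finite digraph without sources or sinks and let $n\ge 1$. Then the $n$th-order coresets of $D$ partition $V(D)$, and the sets $\alpha^n(U)$, $U$ ranging over the $n$th-order coresets, also partition $V(D)$. Furthermore, vertices of distinct $n$th-order coresets have no common $n$th-order successor (i.e. if $u,v$ lie in distinct $n$th-order coresets then $\alpha^n(u)\cap\alpha^n(v)=\emptyset$).
   Context: Digraphs are finite; loops allowed, no multiple edges. A sink is a vertex with no successors, a source a vertex with no predecessors. A walk of length $n$ from $u$ to $v$ is a sequence of vertices $u=v_0,v_1,\ldots,v_n=v$ with $v_{k-1}v_k\in E(D)$ for all $k$. For $S\subseteq V(D)$, $\alpha^n(S)$ is the set of vertices $v$ such that some walk of length $n$ goes from a vertex of $S$ to $v$ (the $n$th-order successors), and $\beta^n(S)$ the set of vertices $u$ such that some walk of length $n$ goes from $u$ to a vertex of $S$. The digraph $D^n$ has vertex set $V(D)$ and an edge $uv$ iff $D$ has a walk of length $n$ from $u$ to $v$. The $n$th-order coresets of $D$ are the coresets of $D^n$, where a coreset of a digraph $H$ is either the set of all sinks of $H$ or a minimal nonempty set $U\subseteq V(H)$ with $\beta_H(\alpha_H(U))=U$ (here $\alpha_H,\beta_H$ denote successor and predecessor sets in $H$). For $D$ without sources or sinks, the $n$th-order coresets are exactly the minimal nonempty sets $U$ with $\beta^n(\alpha^n(U))=U$. -}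

module Defs where

open import Data.Nat using (ℕ; zero; suc)
open import Data.Fin using (Fin)
open import Data.Bool using (Bool; true)
open import Data.Product using (Σ; ∃; _×_; _,_)
open import Data.Sum using (_⊎_)
open import Relation.Nullary using (¬_)
open import Relation.Binary.PropositionalEquality using (_≡_)
open import Relation.Unary using (Pred; _∈_; _⊆_; _≐_; Satisfiable)
open import Level using (0ℓ)

-- A finite digraph on vertex set Fin m, given by its adjacency matrix
-- (loops allowed, no multiple edges).
Digraph : ℕ → Set
Digraph m = Fin m → Fin m → Bool

Edge : ∀ {m} → Digraph m → Fin m → Fin m → Set
Edge D u v = D u v ≡ true

data Walk {m : ℕ} (D : Digraph m) : ℕ → Fin m → Fin m → Set where
  nil  : ∀ {u} → Walk D zero u u
  cons : ∀ {n u v w} → Edge D u v → Walk D n v w → Walk D (suc n) u w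

VSet : ℕ → Set₁
VSet m = Pred (Fin m) 0ℓ

NoSinks : ∀ {m} → Digraph m → Set
NoSinks D = ∀ u → ∃ λ v → Edge D u v

NoSources : ∀ {m} → Digraph m → Set
NoSources D = ∀ v → ∃ λ u → Edge D u v

Rel : ℕ → Set₁
Rel m = Fin m → Fin m → Set

succSet : ∀ {m} → Rel m → VSet m → VSet m
succSet H S v = ∃ λ u → u ∈ S × H u v

predSet : ∀ {m} → Rel m → VSet m → VSet m
predSet H S u = ∃ λ v → v ∈ S × H u v

Sinks : ∀ {m} → Rel m → VSet m
Sinks H u = ∀ v → ¬ H u v

MinimalClosed : ∀ {m} → Rel m → VSet m → Set₁
MinimalClosed H U =
  Satisfiable U ×
  (predSet H (succSet H U) ≐ U) ×
  (∀ (W : VSet _) → Satisfiable W → W ⊆ U →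
     predSet H (succSet H W) ≐ W → U ⊆ W)

Coreset : ∀ {m} → Rel m → VSet m → Set₁
Coreset H U = (Satisfiable U × (U ≐ Sinks H)) ⊎ MinimalClosed H U

Power : ∀ {m} → Digraph m → ℕ → Rel m
Power D n = Walk D n

αⁿ : ∀ {m} → Digraph m → ℕ → VSet m → VSet m
αⁿ D n S v = ∃ λ u → u ∈ S × Walk D n u v

βⁿ : ∀ {m} → Digraph m → ℕ → VSet m → VSet m
βⁿ D n S u = ∃ λ v → v ∈ S × Walk D n u v

CoresetN : ∀ {m} → Digraph m → ℕ → VSet m → Set₁
CoresetN D n = Coreset (Power D n)

module Submission where

open import Defs
open import Data.Nat using (ℕ; _≥_; zero; suc)
open import Data.Fin using (Fin)
open import Data.Product using (Σ; ∃; _×_; _,_; proj₁; proj₂)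
open import Data.Sum using (inj₁; inj₂)
open import Relation.Nullary using (¬_)
open import Relation.Unary using (_∈_; _⊆_; _≐_)
open import Data.Empty using (⊥; ⊥-elim)

-- In a relation H without sinks, U ⊆ β(α(U)) always holds, so β(α(U)) = U
-- says exactly that U is closed under "having a common successor".  The
-- minimal nonempty such sets are the classes of the equivalence relation
-- generated by this relation, and the set of sinks is empty, so the coresets
-- are precisely these classes.  Applied to H = Dⁿ this gives the partition
-- into coresets and the disjointness of successor sets of distinct coresets;
-- as D has no sources, every vertex is an n-th order successor of some
-- vertex, so the sets αⁿ(U) cover V(D) as well.

module SinklessRelation {m : ℕ} (H : Rel m) (noSinks : ∀ u → ∃ λ v → H u v) where

  CommonSuccessorClosed : VSet m → Set
  CommonSuccessorClosed U = ∀ {x y w} → H x w → H y w → x ∈ U → y ∈ U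

  predSet-succSet⊆⇒commonSuccessorClosed :
    ∀ {U} → predSet H (succSet H U) ⊆ U → CommonSuccessorClosed U
  predSet-succSet⊆⇒commonSuccessorClosed βα⊆U {x} {w = w} hx hy x∈U =
    βα⊆U (w , (x , x∈U , hx) , hy)

  ⊆predSet-succSet : ∀ U → U ⊆ predSet H (succSet H U)
  ⊆predSet-succSet U {x} x∈U = let (w , h) = noSinks x in w , (x , x∈U , h) , h

  -- Linked u is the class of u under the equivalence relation generated by
  -- "having a common successor", presented by zigzag paths starting at u.
  data Linked (u : Fin m) : Fin m → Set where
    here : Linked u u
    step : ∀ {x y w} → Linked u x → H x w → H y w → Linked u y

  Linked⊆ : ∀ {U u} → CommonSuccessorClosed U → u ∈ U → Linked u ⊆ U
  Linked⊆ closed u∈U here              = u∈U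
  Linked⊆ closed u∈U (step path hx hy) = closed hx hy (Linked⊆ closed u∈U path)

  Linked⁻¹⊆ : ∀ {U u y} → CommonSuccessorClosed U → y ∈ U → Linked u y → u ∈ U
  Linked⁻¹⊆ closed y∈U here              = y∈U
  Linked⁻¹⊆ closed y∈U (step path hx hy) = Linked⁻¹⊆ closed (closed hy hx y∈U) path

  predSet-succSet-Linked : ∀ u → predSet H (succSet H (Linked u)) ≐ Linked u
  predSet-succSet-Linked u =
    (λ { (w , (y , path , hy) , hx) → step path hy hx }) , ⊆predSet-succSet (Linked u)

  Linked-minimalClosed : ∀ u → MinimalClosed H (Linked u)
  Linked-minimalClosed u = (u , here) , predSet-succSet-Linked u , minimal
    where
    minimal : ∀ W → ∃ (_∈ W) → W ⊆ Linked u → predSet H (succSet H W) ≐ W →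
              Linked u ⊆ W
    minimal W (w , w∈W) W⊆ (βα⊆W , _) =
      Linked⊆ closed (Linked⁻¹⊆ closed w∈W (W⊆ w∈W))
      where
      closed : CommonSuccessorClosed W
      closed = predSet-succSet⊆⇒commonSuccessorClosed βα⊆W

  minimalClosed≐Linked : ∀ {U v} → MinimalClosed H U → v ∈ U → U ≐ Linked v
  minimalClosed≐Linked {U} {v} (_ , (βα⊆U , _) , minimal) v∈U =
    minimal (Linked v) (v , here) Linked-v⊆U (predSet-succSet-Linked v) , Linked-v⊆U
    where
    Linked-v⊆U : Linked v ⊆ U
    Linked-v⊆U = Linked⊆ (predSet-succSet⊆⇒commonSuccessorClosed βα⊆U) v∈U

  coreset⇒minimalClosed : ∀ {U} → Coreset H U → MinimalClosed H U
  coreset⇒minimalClosed (inj₁ ((u , u∈U) , U⊆Sinks , _)) =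
    ⊥-elim (U⊆Sinks u∈U (proj₁ (noSinks u)) (proj₂ (noSinks u)))
  coreset⇒minimalClosed (inj₂ minimalClosed) = minimalClosed

  coreset≐Linked : ∀ {U v} → Coreset H U → v ∈ U → U ≐ Linked v
  coreset≐Linked coreset = minimalClosed≐Linked (coreset⇒minimalClosed coreset)

  Linked-coreset : ∀ u → Coreset H (Linked u)
  Linked-coreset u = inj₂ (Linked-minimalClosed u)

  coresets-sharing-vertex : ∀ {U U′ v} → Coreset H U → Coreset H U′ →
                            v ∈ U → v ∈ U′ → U ≐ U′
  coresets-sharing-vertex c c′ v∈U v∈U′ =
    let (U⊆ , ⊆U) = coreset≐Linked c v∈U ; (U′⊆ , ⊆U′) = coreset≐Linked c′ v∈U′
    in (λ x∈U → ⊆U′ (U⊆ x∈U)) , (λ x∈U′ → ⊆U (U′⊆ x∈U′))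

  coresets-sharing-successor : ∀ {U U′ u v w} → Coreset H U → Coreset H U′ →
                               u ∈ U → v ∈ U′ → H u w → H v w → U ≐ U′
  coresets-sharing-successor {U′ = U′} c c′ u∈U v∈U′ hu hv =
    coresets-sharing-vertex c c′ u∈U (closed hv hu v∈U′)
    where
    closed : CommonSuccessorClosed U′
    closed = predSet-succSet⊆⇒commonSuccessorClosed
               (proj₁ (proj₁ (proj₂ (coreset⇒minimalClosed c′))))

_▷_ : ∀ {m} {D : Digraph m} {n u v w} → Walk D n u v → Edge D v w → Walk D (suc n) u w
nil       ▷ e = cons e nil
cons e′ p ▷ e = cons e′ (p ▷ e)

walk-from : ∀ {m} (D : Digraph m) → NoSinks D → ∀ n u → ∃ λ v → Walk D n u v
walk-from D noSinks zero    u = u , nil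
walk-from D noSinks (suc n) u =
  let (v , e) = noSinks u ; (w , p) = walk-from D noSinks n v in w , cons e p

walk-to : ∀ {m} (D : Digraph m) → NoSources D → ∀ n v → ∃ λ u → Walk D n u v
walk-to D noSources zero    v = v , nil
walk-to D noSources (suc n) v =
  let (u , e) = noSources v ; (w , p) = walk-to D noSources n u in w , p ▷ e

corollary7 : ∀ {m : ℕ} (D : Digraph m) → NoSources D → NoSinks D →
    ∀ (n : ℕ) → n ≥ 1 →
    -- the n-th order coresets partition V(D)
    ((∀ (v : Fin m) → Σ (VSet m) λ U → CoresetN D n U × v ∈ U) ×
     (∀ (U U′ : VSet m) → CoresetN D n U → CoresetN D n U′ →
        ∀ (v : Fin m) → v ∈ U → v ∈ U′ → U ≐ U′)) ×
    -- the sets α^n(U), U an n-th order coreset, partition V(D)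
    ((∀ (v : Fin m) → Σ (VSet m) λ U → CoresetN D n U × v ∈ αⁿ D n U) ×
     (∀ (U U′ : VSet m) → CoresetN D n U → CoresetN D n U′ →
        ∀ (v : Fin m) → v ∈ αⁿ D n U → v ∈ αⁿ D n U′ → U ≐ U′)) ×
    -- vertices of distinct n-th order coresets have no common n-th order successor
    (∀ (U U′ : VSet m) → CoresetN D n U → CoresetN D n U′ → ¬ (U ≐ U′) →
       ∀ (u v w : Fin m) → u ∈ U → v ∈ U′ →
       Walk D n u w → Walk D n v w → ⊥)
corollary7 D noSources noSinks n _ =
  ( (λ v → Linked v , Linked-coreset v , here)
  , (λ U U′ c c′ v → coresets-sharing-vertex c c′) )
  , ( (λ v → let (u , p) = walk-to D noSources n v
             in Linked u , Linked-coreset u , (u , here , p))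
    , (λ { U U′ c c′ v (u , u∈U , p) (u′ , u′∈U′ , p′) →
           coresets-sharing-successor c c′ u∈U u′∈U′ p p′ }) )
  , (λ U U′ c c′ U≉U′ u v w u∈U v∈U′ p q →
       U≉U′ (coresets-sharing-successor c c′ u∈U v∈U′ p q))
  where open SinklessRelation (Power D n) (walk-from D noSinks n)
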